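{- Let $G$ be a graph, let $X\subseteq V(G)$, and let $u,v$ be two distinct vertices of $G$ that belong to the same connected component of $G-X$. Let $\alpha$ be a linear arrangement of $G$ with $\alpha(u)<\alpha(x)<\alpha(v)$ for every $x\in X$. Then $\mathrm{nc}(\alpha,G-X)\ge |X|$.
   Context: A linear arrangement of $G=(V,E)$ is a bijection $\alpha:V\to\{1,\dots,|V|\}$. For a subgraph $G'$ of $G$, $\mathrm{nc}(\alpha,G')=\sum_{uv\in E(G')}(|\alpha(u)-\alpha(v)|-1)$. -}

module Defs where

open import Data.Nat using (ℕ; _∸_; _+_; _<ᵇ_; ∣_-_∣)
open import Data.Bool using (Bool; true; false; _∧_; not; if_then_else_)
open import Data.Fin using (Fin; toℕ)
open import Data.Fin.Subset using (Subset; _∈_; _∉_)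
open import Data.Fin.Subset.Properties using (_∈?_)
open import Data.Fin.Permutation using (Permutation′; _⟨$⟩ʳ_)
open import Data.List using (List; allFin; map)
open import Data.Nat.ListAction using (sum)
open import Data.Product using (_×_)
open import Relation.Binary.PropositionalEquality using (_≡_)
open import Relation.Binary.Construct.Closure.ReflexiveTransitive using (Star)
open import Relation.Nullary.Decidable using (⌊_⌋)

record Graph (n : ℕ) : Set where
  field
    adj   : Fin n → Fin n → Bool
    sym   : ∀ i j → adj i j ≡ adj j i
    irrefl : ∀ i → adj i i ≡ false
open Graph public

-- A linear arrangement: a bijection V → positions (positions 0..n-1;
-- shifting to 1..n does not affect any difference used below).
Arrangement : ℕ → Set
Arrangement n = Permutation′ n

pos : ∀ {n} → Arrangement n → Fin n → ℕ
pos α i = toℕ (α ⟨$⟩ʳ i)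

EdgeMinus : ∀ {n} → Graph n → Subset n → Fin n → Fin n → Set
EdgeMinus G X a b = a ∉ X × b ∉ X × adj G a b ≡ true

ConnectedMinus : ∀ {n} → Graph n → Subset n → Fin n → Fin n → Set
ConnectedMinus G X u v = u ∉ X × v ∉ X × Star (EdgeMinus G X) u v

isEdgeMinus : ∀ {n} → Graph n → Subset n → Fin n → Fin n → Bool
isEdgeMinus G X i j =
  (toℕ i <ᵇ toℕ j) ∧ adj G i j ∧ not ⌊ i ∈? X ⌋ ∧ not ⌊ j ∈? X ⌋

-- nc(α, G - X) = Σ_{uv ∈ E(G - X)} (|α(u) - α(v)| - 1),
-- each unordered edge counted once (as the ordered pair with i < j).
ncMinus : ∀ {n} → Arrangement n → Graph n → Subset n → ℕ
ncMinus {n} α G X =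
  sum (map (λ i → sum (map (λ j →
         if isEdgeMinus G X i j then ∣ pos α i - pos α j ∣ ∸ 1 else 0)
       (allFin n))) (allFin n))

-- Every x ∈ X is passed over by an edge of G − X: along a walk from u to v in G − X the
-- position under α goes from below α(x) to above it, and it cannot land on α(x) since x is
-- not on the walk, so a single edge jumps over α(x). An edge ij passes over at most
-- |α(i) − α(j)| − 1 vertices, so counting the pairs (x, edge passing over x) in two ways
-- gives |X| ≤ nc(α, G − X).

module Submission where

open import Defs hiding (sym)
open import Data.Nat using (ℕ; zero; suc; _+_; _∸_; _<_; _≤_; ∣_-_∣; z≤n; s≤s)
open import Data.Nat.Properties
open import Data.Nat.ListAction using (sum)
open import Data.Bool using (true; false; if_then_else_)
open import Data.Bool.Properties using (T-≡)
open import Data.Fin using (Fin; zero; suc; toℕ)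
open import Data.Fin.Properties using (toℕ-injective)
open import Data.Fin.Subset using (Subset; _∈_; ∣_∣)
open import Data.Fin.Subset.Properties using (_∈?_)
open import Data.Fin.Permutation using (_⟨$⟩ˡ_; inverseˡ)
open import Data.List using (allFin; map; tabulate)
open import Data.List.Properties using (map-tabulate)
open import Data.Vec using (_∷_; []; here; there)
open import Data.Vec.Functional using (Vector)
open import Data.Product using (_×_; _,_; proj₁; proj₂; ∃₂)
open import Data.Empty using (⊥-elim)
open import Function using (Equivalence)
open import Relation.Binary using (Rel; tri<; tri≈; tri>)
open import Relation.Binary.PropositionalEquality
open import Relation.Binary.Construct.Closure.ReflexiveTransitive using (Star; ε; _◅_)
open import Relation.Nullary using (yes; no; ¬_)
open import Relation.Nullary.Decidable using (dec-no)
open import Algebra.Properties.CommutativeMonoid.Sum +-0-commutativeMonoid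
  using (sum-syntax; ∑-distrib-+; ∑-comm; ∑-permute; sum-cong-≗; sum-replicate-zero)

∑-mono-≤ : ∀ {n} {f g : Vector ℕ n} → (∀ i → f i ≤ g i) → ∑[ i < n ] f i ≤ ∑[ i < n ] g i
∑-mono-≤ {zero}  f≤g = z≤n
∑-mono-≤ {suc n} f≤g = +-mono-≤ (f≤g zero) (∑-mono-≤ (λ i → f≤g (suc i)))

term≤∑ : ∀ {n} (f : Vector ℕ n) i → f i ≤ ∑[ j < n ] f j
term≤∑ f zero    = m≤m+n _ _
term≤∑ f (suc i) = ≤-trans (term≤∑ (λ j → f (suc j)) i) (m≤n+m _ _)

∑-if-≤ : ∀ {n} b {f : Vector ℕ n} {m} → ∑[ i < n ] f i ≤ m →
         ∑[ i < n ] (if b then f i else 0) ≤ (if b then m else 0)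
∑-if-≤     true  ∑f≤m = ∑f≤m
∑-if-≤ {n} false _    = ≤-reflexive (sum-replicate-zero n)

∣p∣≤∑ : ∀ {n} (p : Subset n) {f : Vector ℕ n} → (∀ x → x ∈ p → 1 ≤ f x) → ∣ p ∣ ≤ ∑[ x < n ] f x
∣p∣≤∑ []          _   = z≤n
∣p∣≤∑ (true ∷ p)  hit = +-mono-≤ (hit zero here) (∣p∣≤∑ p (λ x x∈p → hit (suc x) (there x∈p)))
∣p∣≤∑ (false ∷ p) hit = ≤-trans (∣p∣≤∑ p (λ x x∈p → hit (suc x) (there x∈p))) (m≤n+m _ _)

sum-map-allFin : ∀ n (f : Fin n → ℕ) → sum (map f (allFin n)) ≡ ∑[ i < n ] f i
sum-map-allFin n f = trans (cong sum (map-tabulate (λ i → i) f)) (sum-tabulate n f)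
  where
  sum-tabulate : ∀ n (f : Fin n → ℕ) → sum (tabulate f) ≡ ∑[ i < n ] f i
  sum-tabulate zero    f = refl
  sum-tabulate (suc n) f = cong (f zero +_) (sum-tabulate n (λ i → f (suc i)))

[_≤_<_] : ℕ → ℕ → ℕ → ℕ
[ l     ≤ k     < zero  ] = 0
[ zero  ≤ zero  < suc h ] = 1
[ zero  ≤ suc k < suc h ] = [ zero ≤ k < h ]
[ suc l ≤ zero  < suc h ] = 0
[ suc l ≤ suc k < suc h ] = [ l ≤ k < h ]

[≤<]-hit : ∀ {l k h} → l ≤ k → k < h → [ l ≤ k < h ] ≡ 1
[≤<]-hit {zero}  {zero}  {suc h} z≤n       _         = refl
[≤<]-hit {zero}  {suc k} {suc h} z≤n       (s≤s k<h) = [≤<]-hit {zero} z≤n k<h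
[≤<]-hit {suc l} {suc k} {suc h} (s≤s l≤k) (s≤s k<h) = [≤<]-hit l≤k k<h

∑[≤<]≤∸ : ∀ n l h → ∑[ p < n ] [ l ≤ toℕ p < h ] ≤ h ∸ l
∑[≤<]≤∸ zero    l       h       = z≤n
∑[≤<]≤∸ (suc n) l       zero    = ≤-reflexive (trans (sum-replicate-zero (suc n)) (sym (0∸n≡0 l)))
∑[≤<]≤∸ (suc n) zero    (suc h) = s≤s (∑[≤<]≤∸ n zero h)
∑[≤<]≤∸ (suc n) (suc l) (suc h) = ∑[≤<]≤∸ n l h

strictlyBetween : ℕ → ℕ → ℕ → ℕ
strictlyBetween a b k = [ suc a ≤ k < b ] + [ suc b ≤ k < a ]

strictlyBetween-comm : ∀ a b k → strictlyBetween a b k ≡ strictlyBetween b a k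
strictlyBetween-comm a b k = +-comm [ suc a ≤ k < b ] [ suc b ≤ k < a ]

strictlyBetween-hit : ∀ {a b k} → a < k → k < b → 1 ≤ strictlyBetween a b k
strictlyBetween-hit {a} {b} {k} a<k k<b =
  ≤-trans (≤-reflexive (sym ([≤<]-hit a<k k<b))) (m≤m+n _ [ suc b ≤ k < a ])

∑strictlyBetween≤∣-∣∸1 : ∀ n a b → ∑[ p < n ] strictlyBetween a b (toℕ p) ≤ ∣ a - b ∣ ∸ 1
∑strictlyBetween≤∣-∣∸1 n a b = begin
  ∑[ p < n ] strictlyBetween a b (toℕ p)
    ≡⟨ ∑-distrib-+ {n} (λ p → [ suc a ≤ toℕ p < b ]) (λ p → [ suc b ≤ toℕ p < a ]) ⟩
  ∑[ p < n ] [ suc a ≤ toℕ p < b ] + ∑[ p < n ] [ suc b ≤ toℕ p < a ]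
    ≤⟨ +-mono-≤ (∑[≤<]≤∸ n (suc a) b) (∑[≤<]≤∸ n (suc b) a) ⟩
  b ∸ suc a + (a ∸ suc b)
    ≡⟨ gap a b ⟩
  ∣ a - b ∣ ∸ 1 ∎
  where
  open ≤-Reasoning
  gap : ∀ a b → b ∸ suc a + (a ∸ suc b) ≡ ∣ a - b ∣ ∸ 1
  gap zero    zero    = refl
  gap zero    (suc b) = +-identityʳ b
  gap (suc a) zero    = refl
  gap (suc a) (suc b) = gap a b

Star-step-across : ∀ {a ℓ} {A : Set a} {R : Rel A ℓ} (f : A → ℕ) {t x y} →
                   Star R x y → f x < t → t ≤ f y → ∃₂ λ c d → R c d × f c < t × t ≤ f d
Star-step-across f ε fx<t t≤fx = ⊥-elim (<⇒≱ fx<t t≤fx)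
Star-step-across f {t} (_◅_ {j = z} xRz z⋆y) fx<t t≤fy with f z <? t
... | yes fz<t = Star-step-across f z⋆y fz<t t≤fy
... | no  fz≮t = _ , _ , xRz , fx<t , ≮⇒≥ fz≮t

pos-injective : ∀ {n} (α : Arrangement n) {c d} → pos α c ≡ pos α d → c ≡ d
pos-injective α eq = trans (sym (inverseˡ α)) (trans (cong (α ⟨$⟩ˡ_) (toℕ-injective eq)) (inverseˡ α))

∑strictlyBetween-pos≤∣-∣∸1 : ∀ {n} (α : Arrangement n) a b →
                            ∑[ x < n ] strictlyBetween a b (pos α x) ≤ ∣ a - b ∣ ∸ 1
∑strictlyBetween-pos≤∣-∣∸1 {n} α a b =
  ≤-trans (≤-reflexive (sym (∑-permute (λ p → strictlyBetween a b (toℕ p)) α)))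
          (∑strictlyBetween≤∣-∣∸1 n a b)

module _ {n} (G : Graph n) (X : Subset n) where

  EdgeMinus-sym : ∀ {c d} → EdgeMinus G X c d → EdgeMinus G X d c
  EdgeMinus-sym {c} {d} (c∉X , d∉X , cd) = d∉X , c∉X , trans (Graph.sym G d c) cd

  EdgeMinus-irrefl : ∀ {c} → ¬ EdgeMinus G X c c
  EdgeMinus-irrefl {c} (_ , _ , cc) with () ← trans (sym cc) (irrefl G c)

  isEdgeMinus-true : ∀ {c d} → toℕ c < toℕ d → EdgeMinus G X c d → isEdgeMinus G X c d ≡ true
  isEdgeMinus-true {c} {d} c<d (c∉X , d∉X , cd)
    rewrite Equivalence.to T-≡ (<⇒<ᵇ c<d) | cd | dec-no (c ∈? X) c∉X | dec-no (d ∈? X) d∉X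
    = refl

  module _ (α : Arrangement n) where

    stretch : Fin n → Fin n → ℕ
    stretch i j = if isEdgeMinus G X i j then ∣ pos α i - pos α j ∣ ∸ 1 else 0

    crosses : Fin n → Fin n → Fin n → ℕ
    crosses i j x = if isEdgeMinus G X i j then strictlyBetween (pos α i) (pos α j) (pos α x) else 0

    ncMinus≡∑∑stretch : ncMinus α G X ≡ ∑[ i < n ] ∑[ j < n ] stretch i j
    ncMinus≡∑∑stretch = begin
      sum (map (λ i → sum (map (stretch i) (allFin n))) (allFin n))
        ≡⟨ sum-map-allFin n _ ⟩
      ∑[ i < n ] sum (map (stretch i) (allFin n))
        ≡⟨ sum-cong-≗ (λ i → sum-map-allFin n (stretch i)) ⟩
      ∑[ i < n ] ∑[ j < n ] stretch i j ∎
      where open ≡-Reasoning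

    ∑crosses≤stretch : ∀ i j → ∑[ x < n ] crosses i j x ≤ stretch i j
    ∑crosses≤stretch i j =
      ∑-if-≤ {n} (isEdgeMinus G X i j) (∑strictlyBetween-pos≤∣-∣∸1 α (pos α i) (pos α j))

    ≤∑∑crosses : ∀ {i j x} → isEdgeMinus G X i j ≡ true →
                 1 ≤ strictlyBetween (pos α i) (pos α j) (pos α x) → 1 ≤ ∑[ i < n ] ∑[ j < n ] crosses i j x
    ≤∑∑crosses {i} {j} {x} ij hit = begin
      1                                             ≤⟨ hit ⟩
      strictlyBetween (pos α i) (pos α j) (pos α x) ≡⟨ cong (if_then _ else 0) (sym ij) ⟩
      crosses i j x                                 ≤⟨ term≤∑ (λ j → crosses i j x) j ⟩
      ∑[ j < n ] crosses i j x                      ≤⟨ term≤∑ (λ i → ∑[ j < n ] crosses i j x) i ⟩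
      ∑[ i < n ] ∑[ j < n ] crosses i j x           ∎
      where open ≤-Reasoning

    crossed-by-edge : ∀ {c d x} → EdgeMinus G X c d → 1 ≤ strictlyBetween (pos α c) (pos α d) (pos α x) →
                      1 ≤ ∑[ i < n ] ∑[ j < n ] crosses i j x
    crossed-by-edge {c} {d} cd hit with <-cmp (toℕ c) (toℕ d)
    ... | tri< c<d _ _ = ≤∑∑crosses (isEdgeMinus-true c<d cd) hit
    ... | tri≈ _ c≡d _ = ⊥-elim (EdgeMinus-irrefl (subst (EdgeMinus G X c) (sym (toℕ-injective c≡d)) cd))
    ... | tri> _ _ d<c = ≤∑∑crosses (isEdgeMinus-true d<c (EdgeMinus-sym cd))
                           (≤-trans hit (≤-reflexive (strictlyBetween-comm (pos α c) (pos α d) _)))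

    member-crossed : ∀ {u v x} → Star (EdgeMinus G X) u v → x ∈ X → pos α u < pos α x → pos α x < pos α v →
                     1 ≤ ∑[ i < n ] ∑[ j < n ] crosses i j x
    member-crossed {x = x} u⋆v x∈X u<x x<v with Star-step-across (pos α) u⋆v u<x (<⇒≤ x<v)
    ... | c , d , cd@(_ , d∉X , _) , c<x , x≤d =
      crossed-by-edge cd (strictlyBetween-hit c<x (≤∧≢⇒< x≤d x≢d))
      where
      x≢d : pos α x ≢ pos α d
      x≢d x≡d = d∉X (subst (_∈ X) (pos-injective α x≡d) x∈X)

lemma2p2 : ∀ {n} (G : Graph n) (X : Subset n) (u v : Fin n) (α : Arrangement n)
         → u ≢ v
         → ConnectedMinus G X u v
         → (∀ x → x ∈ X → pos α u < pos α x × pos α x < pos α v)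
         → ∣ X ∣ ≤ ncMinus α G X
lemma2p2 {n} G X u v α _ (_ , _ , u⋆v) between = begin
  ∣ X ∣                                    ≤⟨ ∣p∣≤∑ X crossed ⟩
  ∑[ x < n ] ∑[ i < n ] ∑[ j < n ] C i j x  ≡⟨ ∑-comm (λ x i → ∑[ j < n ] C i j x) ⟩
  ∑[ i < n ] ∑[ x < n ] ∑[ j < n ] C i j x  ≡⟨ sum-cong-≗ (λ i → ∑-comm (λ x j → C i j x)) ⟩
  ∑[ i < n ] ∑[ j < n ] ∑[ x < n ] C i j x  ≤⟨ ∑-mono-≤ (λ i → ∑-mono-≤ (∑crosses≤stretch G X α i)) ⟩
  ∑[ i < n ] ∑[ j < n ] stretch G X α i j   ≡⟨ ncMinus≡∑∑stretch G X α ⟨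
  ncMinus α G X                            ∎
  where
  open ≤-Reasoning
  C : Fin n → Fin n → Fin n → ℕ
  C = crosses G X α
  crossed : ∀ x → x ∈ X → 1 ≤ ∑[ i < n ] ∑[ j < n ] C i j x
  crossed x x∈X = member-crossed G X α u⋆v x∈X (proj₁ (between x x∈X)) (proj₂ (between x x∈X))
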